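{- Let $n\geqslant 5$ be odd and $\mathcal{V}=\mathcal{V}(2,n)$. Then $$\mathcal{V}\cap[2,5n+2]=\{2\}\cup\{n,n+2,\dots,2n-3,2n-1\}\cup\{2n\}\cup\{2n+1,2n+3,\dots,3n-4,3n-2\}\cup\{3n+2,3n+6,\dots,5n-8,5n-4\}\cup\{5n+2\},$$ where the first and third progressions have common difference $2$ and the fourth has common difference $4$.
   Context: For positive integers $a<b$, the sequence $\mathcal{V}(a,b)=(a_m)_{m\geqslant 1}$ is defined greedily by $a_1=a$, $a_2=b$, and, for $m\geqslant 2$, $a_{m+1}$ is the smallest integer larger than $a_m$ that can be written as $a_i+a_j$ with $i\leqslant j\leqslant m$ (the two earlier terms not necessarily distinct) in exactly one way (representations are unordered pairs). The sequence is identified with its set of terms. -}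

module Defs where

open import Data.Nat using (ℕ; zero; suc; _+_; _*_; _≤_; _<_; _≡ᵇ_; _≤ᵇ_)
open import Data.Bool using (Bool; true; false; if_then_else_; _∧_)
open import Data.List using (List; []; _∷_; _++_; [_]; length)
open import Data.List.Membership.Propositional using (_∈_)
open import Data.Product using (∃)

-- For a list of distinct terms this counts representations x = a_i + a_j, i ≤ j.
countWith : ℕ → List ℕ → ℕ → ℕ
countWith u [] x = 0
countWith u (v ∷ vs) x = (if (u + v) ≡ᵇ x then 1 else 0) + countWith u vs x

reps : List ℕ → ℕ → ℕ
reps [] x = 0
reps (u ∷ us) x = countWith u (u ∷ us) x + reps us x

uniqueRep : List ℕ → ℕ → Bool
uniqueRep L x = reps L x ≡ᵇ 1

searchFrom : List ℕ → ℕ → ℕ → ℕ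
searchFrom L c zero = c
searchFrom L c (suc f) = if uniqueRep L (suc c) then suc c else searchFrom L (suc c) f

last : ℕ → List ℕ → ℕ
last d [] = d
last d (x ∷ xs) = last x xs

-- Given the terms a_1 < ... < a_m (m ≥ 2), the next term a_{m+1}.
-- a_{m-1} + a_m always has exactly one representation (it is the unique way
-- of writing it with the largest term), so the search range
-- a_m + 1 , ... , a_m + a_{m-1} + ... suffices; we search up to a_m + a_m,
-- which bounds a_{m-1} + a_m.
nextTerm : List ℕ → ℕ
nextTerm L = searchFrom L (last 0 L) (last 0 L)

terms : ℕ → ℕ → ℕ → List ℕ
terms a b zero = a ∷ b ∷ []
terms a b (suc k) = let L = terms a b k in L ++ [ nextTerm L ]

InV : ℕ → ℕ → ℕ → Set
InV a b x = ∃ λ k → x ∈ terms a b k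

-- The greedy rule only looks at the terms found so far: if L lists the terms up to p, the next
-- term is the least y > p with exactly one representation as a sum of elements of L. So it is
-- enough to exhibit the claimed set S and, for every p ∈ S below 5n + 2 with successor q in S,
-- to check that each y strictly between p and q has no or at least two representations by the
-- elements of S up to p, while q has exactly one. Parity does most of the work: all elements of
-- S except 2 and 2n are odd, so a representation of an odd number uses 2 or 2n and is then
-- pinned down by size, while an even number other than 4 and 2n + 2 can only be a sum of two
-- odd elements; that is impossible below 2n and possible in two ways above it, using the block
-- n, n + 2, …, 3n - 2.
module Submission where

open import Defs
open import Data.Nat using (ℕ; zero; suc; _+_; _*_; _≤_; _<_; _≡ᵇ_; z≤n; s≤s; _≟_; _≤?_)
open import Data.Nat.Properties
open import Data.Nat.Divisibility using (_∣_; divides; ∣m∣n⇒∣m+n; ∣-refl)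
open import Data.Nat.Tactic.RingSolver using (solve)
open import Data.Bool using (true; false; T)
open import Data.List using (List; []; _∷_; _++_; [_])
open import Data.List.Membership.Propositional using (_∈_)
open import Data.List.Membership.Propositional.Properties using (∈-++⁺ˡ; ∈-++⁺ʳ; ∈-++⁻)
open import Data.List.Relation.Unary.Any using (here; there)
open import Data.List.Relation.Unary.All as All using (All)
open import Data.List.Relation.Unary.AllPairs as AllPairs using (AllPairs)
import Data.List.Relation.Unary.AllPairs.Properties as AllPairs
open import Data.Product using (∃; _×_; _,_; proj₁; proj₂)
open import Data.Sum using (_⊎_; inj₁; inj₂)
import Data.Sum as Sum
open import Data.Empty using (⊥; ⊥-elim)
open import Function using (_∘_)
open import Function.Bundles using (_⇔_; mk⇔)
open import Function.Properties.Equivalence using () renaming (trans to ⇔-trans)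
open import Relation.Nullary using (¬_; yes; no)
open import Relation.Binary.PropositionalEquality hiding ([_])
open import Relation.Binary.Definitions using (tri<; tri≈; tri>)

Increasing : List ℕ → Set
Increasing = AllPairs _<_

≡ᵇ-true⇒≡ : ∀ m n → (m ≡ᵇ n) ≡ true → m ≡ n
≡ᵇ-true⇒≡ m n eq = ≡ᵇ⇒≡ m n (subst T (sym eq) _)

≡ᵇ-false⇒≢ : ∀ m n → (m ≡ᵇ n) ≡ false → m ≢ n
≡ᵇ-false⇒≢ m n eq m≡n with ≡⇒≡ᵇ m n m≡n
... | t rewrite eq = t

≢⇒≡ᵇ-false : ∀ m n → m ≢ n → (m ≡ᵇ n) ≡ false
≢⇒≡ᵇ-false m n m≢n with m ≡ᵇ n in eq
... | true = ⊥-elim (m≢n (≡ᵇ-true⇒≡ m n eq))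
... | false = refl

∈-tail : ∀ {x w : ℕ} {ws} → x ∈ w ∷ ws → x ≢ w → x ∈ ws
∈-tail (here refl) x≢w = ⊥-elim (x≢w refl)
∈-tail (there x∈ws) _ = x∈ws

countWith≡0 : ∀ u L y → (∀ {v} → v ∈ L → u + v ≢ y) → countWith u L y ≡ 0
countWith≡0 u [] y _ = refl
countWith≡0 u (v ∷ vs) y none with (u + v) ≡ᵇ y in eq
... | true = ⊥-elim (none (here refl) (≡ᵇ-true⇒≡ _ _ eq))
... | false = countWith≡0 u vs y (none ∘ there)

1≤countWith : ∀ u L y {v} → v ∈ L → u + v ≡ y → 1 ≤ countWith u L y
1≤countWith u (w ∷ ws) y v∈L u+v≡y with (u + w) ≡ᵇ y in eq
... | true = s≤s z≤n
1≤countWith u (w ∷ ws) y (here refl) u+v≡y | false = ⊥-elim (≡ᵇ-false⇒≢ _ _ eq u+v≡y)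
1≤countWith u (w ∷ ws) y (there v∈ws) u+v≡y | false = 1≤countWith u ws y v∈ws u+v≡y

countWith≡1 : ∀ u L y {v} → Increasing L → v ∈ L → u + v ≡ y → countWith u L y ≡ 1
countWith≡1 u (w ∷ ws) y (w<ws AllPairs.∷ _) v∈L u+v≡y with (u + w) ≡ᵇ y in eq
... | true = cong suc (countWith≡0 u ws y λ {v′} v′∈ws u+v′≡y →
  <-irrefl (+-cancelˡ-≡ u _ _ (trans (≡ᵇ-true⇒≡ _ _ eq) (sym u+v′≡y))) (All.lookup w<ws v′∈ws))
countWith≡1 u (w ∷ ws) y _ (here refl) u+v≡y | false = ⊥-elim (≡ᵇ-false⇒≢ _ _ eq u+v≡y)
countWith≡1 u (w ∷ ws) y (_ AllPairs.∷ inc) (there v∈ws) u+v≡y | false = countWith≡1 u ws y inc v∈ws u+v≡y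

reps≡0 : ∀ L y → (∀ {u v} → u ∈ L → v ∈ L → u + v ≢ y) → reps L y ≡ 0
reps≡0 [] y _ = refl
reps≡0 (w ∷ ws) y none =
  cong₂ _+_ (countWith≡0 w (w ∷ ws) y (none (here refl)))
            (reps≡0 ws y λ u∈ws v∈ws → none (there u∈ws) (there v∈ws))

1≤reps : ∀ L y {u v} → Increasing L → u ∈ L → v ∈ L → u ≤ v → u + v ≡ y → 1 ≤ reps L y
1≤reps (w ∷ ws) y {u} {v} (w<ws AllPairs.∷ inc) u∈L v∈L u≤v u+v≡y with u ≟ w
... | yes refl = ≤-trans (1≤countWith u (u ∷ ws) y v∈L u+v≡y) (m≤m+n _ _)
... | no u≢w = ≤-trans (1≤reps ws y inc u∈ws v∈ws u≤v u+v≡y) (m≤n+m _ _)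
  where
  u∈ws : u ∈ ws
  u∈ws = ∈-tail u∈L u≢w
  v∈ws : v ∈ ws
  v∈ws = ∈-tail v∈L λ { refl → <⇒≱ (All.lookup w<ws u∈ws) u≤v }

2≤reps : ∀ L y {u₁ v₁ u₂ v₂} → Increasing L →
  u₁ ∈ L → v₁ ∈ L → u₂ ∈ L → v₂ ∈ L → u₁ ≤ v₁ → u₂ ≤ v₂ →
  u₁ + v₁ ≡ y → u₂ + v₂ ≡ y → u₁ < u₂ → 2 ≤ reps L y
2≤reps (w ∷ ws) y {u₁} {v₁} {u₂} {v₂} (w<ws AllPairs.∷ inc)
  u₁∈L v₁∈L u₂∈L v₂∈L u₁≤v₁ u₂≤v₂ eq₁ eq₂ u₁<u₂ with u₁ ≟ w
... | yes refl = +-mono-≤ (1≤countWith u₁ (u₁ ∷ ws) y v₁∈L eq₁) (1≤reps ws y inc u₂∈ws v₂∈ws u₂≤v₂ eq₂)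
  where
  u₂∈ws : u₂ ∈ ws
  u₂∈ws = ∈-tail u₂∈L λ { refl → <-irrefl refl u₁<u₂ }
  v₂∈ws : v₂ ∈ ws
  v₂∈ws = ∈-tail v₂∈L λ { refl → <-irrefl refl (<-≤-trans u₁<u₂ u₂≤v₂) }
... | no u₁≢w = ≤-trans (2≤reps ws y inc u₁∈ws v₁∈ws u₂∈ws v₂∈ws u₁≤v₁ u₂≤v₂ eq₁ eq₂ u₁<u₂) (m≤n+m _ _)
  where
  u₁∈ws : u₁ ∈ ws
  u₁∈ws = ∈-tail u₁∈L u₁≢w
  in-tail : ∀ {x} → u₁ ≤ x → x ∈ w ∷ ws → x ∈ ws
  in-tail u₁≤x x∈L = ∈-tail x∈L λ { refl → <⇒≱ (All.lookup w<ws u₁∈ws) u₁≤x }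
  v₁∈ws : v₁ ∈ ws
  v₁∈ws = in-tail u₁≤v₁ v₁∈L
  u₂∈ws : u₂ ∈ ws
  u₂∈ws = in-tail (<⇒≤ u₁<u₂) u₂∈L
  v₂∈ws : v₂ ∈ ws
  v₂∈ws = in-tail (≤-trans (<⇒≤ u₁<u₂) u₂≤v₂) v₂∈L

reps≡1 : ∀ L y {p q} → Increasing L → p ∈ L → q ∈ L → p ≤ q → p + q ≡ y →
  (∀ {u v} → u ∈ L → v ∈ L → u + v ≡ y → u ≡ p ⊎ u ≡ q) → reps L y ≡ 1
reps≡1 (w ∷ ws) y {p} {q} inc@(w<ws AllPairs.∷ inc′) p∈L q∈L p≤q p+q≡y only with p ≟ w
... | yes refl = cong₂ _+_ (countWith≡1 p (p ∷ ws) y inc q∈L p+q≡y) (reps≡0 ws y none)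
  where
  none : ∀ {u v} → u ∈ ws → v ∈ ws → u + v ≢ y
  none {u} {v} u∈ws v∈ws u+v≡y with only (there u∈ws) (there v∈ws) u+v≡y
  ... | inj₁ refl = <-irrefl refl (All.lookup w<ws u∈ws)
  ... | inj₂ refl = <-irrefl (sym (+-cancelˡ-≡ u _ _ (trans u+v≡y (trans (sym p+q≡y) (+-comm p u)))))
                             (All.lookup w<ws v∈ws)
... | no p≢w = trans (cong (_+ reps ws y) (countWith≡0 w (w ∷ ws) y none)) (reps≡1 ws y inc′ p∈ws q∈ws p≤q p+q≡y only′)
  where
  p∈ws : p ∈ ws
  p∈ws = ∈-tail p∈L p≢w
  w<q : w < q
  w<q = <-≤-trans (All.lookup w<ws p∈ws) p≤q
  q∈ws : q ∈ ws
  q∈ws = ∈-tail q∈L λ { refl → <-irrefl refl w<q }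
  none : ∀ {v} → v ∈ w ∷ ws → w + v ≢ y
  none v∈L w+v≡y with only (here refl) v∈L w+v≡y
  ... | inj₁ refl = p≢w refl
  ... | inj₂ refl = <-irrefl refl w<q
  only′ : ∀ {u v} → u ∈ ws → v ∈ ws → u + v ≡ y → u ≡ p ⊎ u ≡ q
  only′ u∈ws v∈ws = only (there u∈ws) (there v∈ws)

Below : (ℕ → Set) → ℕ → ℕ → Set
Below P c u = P u × u ≤ c

record Enumerates (P : ℕ → Set) (L : List ℕ) (c : ℕ) : Set where
  field
    increasing : Increasing L
    last≡ : last 0 L ≡ c
    sound : ∀ {u} → u ∈ L → Below P c u
    complete : ∀ {u} → Below P c u → u ∈ L

module _ {P : ℕ → Set} {L : List ℕ} {c : ℕ} (E : Enumerates P L c) where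
  open Enumerates E

  uniqueRep-none : ∀ {y} → (∀ {u v} → Below P c u → Below P c v → u + v ≢ y) → uniqueRep L y ≡ false
  uniqueRep-none {y} none rewrite reps≡0 L y (λ u∈L v∈L → none (sound u∈L) (sound v∈L)) = refl

  uniqueRep-two : ∀ {y u₁ v₁ u₂ v₂} → Below P c u₁ → Below P c v₁ → Below P c u₂ → Below P c v₂ →
    u₁ + v₁ ≡ y → u₂ + v₂ ≡ y → u₁ < u₂ → u₁ < v₂ → uniqueRep L y ≡ false
  uniqueRep-two {y} {u₁} {v₁} {u₂} {v₂} u₁∈ v₁∈ u₂∈ v₂∈ eq₁ eq₂ u₁<u₂ u₁<v₂ =
    ≢⇒≡ᵇ-false (reps L y) 1 λ reps≡1 → 1+n≰n (subst (2 ≤_) reps≡1 at-least-two)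
    where
    ordered : ∀ {s t} → Below P c s → Below P c t → s + t ≡ y → u₁ < s → s ≤ t → 2 ≤ reps L y
    ordered {s} {t} s∈ t∈ s+t≡y u₁<s s≤t =
      2≤reps L y increasing (complete u₁∈) (complete v₁∈) (complete s∈) (complete t∈)
        (<⇒≤ (<-≤-trans u₁<s (≤-trans s≤t (<⇒≤ t<v₁)))) s≤t eq₁ s+t≡y u₁<s
      where
      t<v₁ : t < v₁
      t<v₁ = ≰⇒> λ v₁≤t → <-irrefl (trans eq₁ (sym s+t≡y)) (+-mono-<-≤ u₁<s v₁≤t)
    at-least-two : 2 ≤ reps L y
    at-least-two with ≤-total u₂ v₂
    ... | inj₁ u₂≤v₂ = ordered u₂∈ v₂∈ eq₂ u₁<u₂ u₂≤v₂
    ... | inj₂ v₂≤u₂ = ordered v₂∈ u₂∈ (trans (+-comm v₂ u₂) eq₂) u₁<v₂ v₂≤u₂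

  uniqueRep-one : ∀ {y p q} → Below P c p → Below P c q → p + q ≡ y →
    (∀ {u v} → Below P c u → Below P c v → u + v ≡ y → u ≡ p ⊎ u ≡ q) → uniqueRep L y ≡ true
  uniqueRep-one {y} {p} {q} p∈ q∈ p+q≡y only with ≤-total p q
  ... | inj₁ p≤q rewrite reps≡1 L y increasing (complete p∈) (complete q∈) p≤q p+q≡y
                          (λ u∈L v∈L → only (sound u∈L) (sound v∈L)) = refl
  ... | inj₂ q≤p rewrite reps≡1 L y increasing (complete q∈) (complete p∈) q≤p (trans (+-comm q p) p+q≡y)
                          (λ u∈L v∈L u+v≡y → Sum.swap (only (sound u∈L) (sound v∈L) u+v≡y)) = refl

searchFrom-≥ : ∀ L c f → c ≤ searchFrom L c f
searchFrom-≥ L c zero = ≤-refl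
searchFrom-≥ L c (suc f) with uniqueRep L (suc c)
... | true = n≤1+n c
... | false = ≤-trans (n≤1+n c) (searchFrom-≥ L (suc c) f)

searchFrom-> : ∀ L c f → c < searchFrom L c (suc f)
searchFrom-> L c f with uniqueRep L (suc c)
... | true = ≤-refl
... | false = searchFrom-≥ L (suc c) f

searchFrom-finds : ∀ L c f {q} → c < q → q ≤ c + f →
  (∀ {y} → c < y → y < q → uniqueRep L y ≡ false) → uniqueRep L q ≡ true → searchFrom L c f ≡ q
searchFrom-finds L c zero c<q q≤c+0 _ _ = ⊥-elim (<⇒≱ c<q (subst (_ ≤_) (+-identityʳ c) q≤c+0))
searchFrom-finds L c (suc f) {q} c<q q≤c+f skipped found with suc c ≟ q
... | yes refl rewrite found = refl
... | no c+1≢q rewrite skipped ≤-refl (≤∧≢⇒< c<q c+1≢q) =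
  searchFrom-finds L (suc c) f (≤∧≢⇒< c<q c+1≢q) (subst (q ≤_) (+-suc c f) q≤c+f)
    (λ c+1<y → skipped (<-trans (n<1+n c) c+1<y)) found

last-++ : ∀ d L x → last d (L ++ [ x ]) ≡ x
last-++ d [] x = refl
last-++ d (y ∷ L) x = last-++ y L x

last<nextTerm : ∀ L → 1 ≤ last 0 L → last 0 L < nextTerm L
last<nextTerm L 1≤last with last 0 L
... | suc c = searchFrom-> L (suc c) c

record Successor (P : ℕ → Set) (p : ℕ) : Set where
  field
    next : ℕ
    P-next : P next
    p<next : p < next
    next≤p+p : next ≤ p + p
    next-least : ∀ {z} → P z → p < z → next ≤ z
    skipped : ∀ {L} → Enumerates P L p → ∀ {y} → p < y → y < next → uniqueRep L y ≡ false
    chosen : ∀ {L} → Enumerates P L p → uniqueRep L next ≡ true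

module _ {P : ℕ → Set} {L : List ℕ} {p : ℕ} (E : Enumerates P L p) (s : Successor P p) where
  open Enumerates E
  open Successor s

  nextTerm≡next : nextTerm L ≡ next
  nextTerm≡next rewrite last≡ = searchFrom-finds L p p p<next next≤p+p (skipped E) (chosen E)

  Enumerates-++ : Enumerates P (L ++ [ next ]) next
  Enumerates-++ = record
    { increasing = AllPairs.++⁺ increasing (All.[] AllPairs.∷ AllPairs.[])
                     (All.tabulate λ u∈L → <-≤-trans (s≤s (proj₂ (sound u∈L))) p<next All.∷ All.[])
    ; last≡ = last-++ 0 L next
    ; sound = sound′
    ; complete = complete′
    }
    where
    sound′ : ∀ {u} → u ∈ L ++ [ next ] → Below P next u
    sound′ u∈ with ∈-++⁻ L u∈
    ... | inj₁ u∈L = proj₁ (sound u∈L) , ≤-trans (proj₂ (sound u∈L)) (<⇒≤ p<next)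
    ... | inj₂ (here refl) = P-next , ≤-refl
    complete′ : ∀ {u} → Below P next u → u ∈ L ++ [ next ]
    complete′ {u} (Pu , u≤next) with u ≤? p
    ... | yes u≤p = ∈-++⁺ˡ (complete (Pu , u≤p))
    ... | no u≰p = ∈-++⁺ʳ L (here (≤-antisym u≤next (next-least Pu (≰⇒> u≰p))))

module _ {a b : ℕ} where

  ∈-terms-mono : ∀ {k K x} → k ≤ K → x ∈ terms a b k → x ∈ terms a b K
  ∈-terms-mono k≤K x∈ with m≤n⇒m<n∨m≡n k≤K
  ... | inj₂ refl = x∈
  ... | inj₁ (s≤s k≤K′) = ∈-++⁺ˡ (∈-terms-mono k≤K′ x∈)

  last-terms-mono : ∀ {K k} → K ≤ k → 1 ≤ last 0 (terms a b K) → last 0 (terms a b K) ≤ last 0 (terms a b k)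
  last-terms-mono K≤k pos with m≤n⇒m<n∨m≡n K≤k
  ... | inj₂ refl = ≤-refl
  last-terms-mono {K} {suc k} _ pos | inj₁ (s≤s K≤k) = begin
    last 0 (terms a b K)           ≤⟨ IH ⟩
    last 0 (terms a b k)           <⟨ last<nextTerm (terms a b k) (≤-trans pos IH) ⟩
    nextTerm (terms a b k)         ≡⟨ last-++ 0 (terms a b k) _ ⟨
    last 0 (terms a b (suc k))     ∎
    where
    open ≤-Reasoning
    IH : last 0 (terms a b K) ≤ last 0 (terms a b k)
    IH = last-terms-mono K≤k pos

  ∈-terms-later : ∀ {K k x} → K ≤ k → 1 ≤ last 0 (terms a b K) →
    x ∈ terms a b k → x ≤ last 0 (terms a b K) → x ∈ terms a b K
  ∈-terms-later K≤k pos x∈ x≤last with m≤n⇒m<n∨m≡n K≤k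
  ... | inj₂ refl = x∈
  ∈-terms-later {K} {suc k} _ pos x∈ x≤last | inj₁ (s≤s K≤k) with ∈-++⁻ (terms a b k) x∈
  ... | inj₁ x∈terms = ∈-terms-later K≤k pos x∈terms x≤last
  ... | inj₂ (here refl) = ⊥-elim (<⇒≱ new>last (≤-trans x≤last mono))
    where
    mono : last 0 (terms a b K) ≤ last 0 (terms a b k)
    mono = last-terms-mono K≤k pos
    new>last : last 0 (terms a b k) < nextTerm (terms a b k)
    new>last = last<nextTerm (terms a b k) (≤-trans pos mono)

module Characterisation {P : ℕ → Set} {a b B : ℕ}
  (initial : Enumerates P (terms a b 0) b)
  (successor : ∀ {p} → P p → b ≤ p → p < B → Successor P p)
  (P-B : P B) (b≤B : b ≤ B) where

  private
    enumerates-upto-B : ∀ fuel {k p} → B ≤ p + fuel → Enumerates P (terms a b k) p → P p → b ≤ p → p ≤ B →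
      ∃ λ K → Enumerates P (terms a b K) B
    enumerates-upto-B fuel {k} {p} B≤p+fuel E Pp b≤p p≤B with p ≟ B
    ... | yes refl = k , E
    enumerates-upto-B zero B≤p+0 _ _ _ p≤B | no p≢B =
      ⊥-elim (p≢B (≤-antisym p≤B (subst (B ≤_) (+-identityʳ _) B≤p+0)))
    enumerates-upto-B (suc fuel) {k} {p} B≤p+fuel E Pp b≤p p≤B | no p≢B =
      enumerates-upto-B fuel {suc k} B≤next+fuel E′ P-next (≤-trans b≤p (<⇒≤ p<next)) (next-least P-B p<B)
      where
      p<B : p < B
      p<B = ≤∧≢⇒< p≤B p≢B
      s : Successor P p
      s = successor Pp b≤p p<B
      open Successor s
      B≤next+fuel : B ≤ next + fuel
      B≤next+fuel = ≤-trans B≤p+fuel (≤-trans (≤-reflexive (+-suc p fuel)) (+-monoˡ-≤ fuel p<next))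
      E′ : Enumerates P (terms a b (suc k)) next
      E′ = subst (λ t → Enumerates P (terms a b k ++ [ t ]) next) (sym (nextTerm≡next E s)) (Enumerates-++ E s)

    1≤b : 1 ≤ b
    1≤b with Enumerates.increasing initial
    ... | (a<b All.∷ All.[]) AllPairs.∷ _ = <-≤-trans (s≤s z≤n) a<b

    enumerates-B : ∃ λ K → Enumerates P (terms a b K) B
    enumerates-B = enumerates-upto-B B {0} (m≤n+m B b) initial P-b ≤-refl b≤B
      where
      P-b : P b
      P-b = proj₁ (Enumerates.sound initial (there (here refl)))

  InV⇔P : ∀ {x} → x ≤ B → InV a b x ⇔ P x
  InV⇔P {x} x≤B = mk⇔ to from
    where
    K : ℕ
    K = proj₁ enumerates-B
    open Enumerates (proj₂ enumerates-B)
    1≤B : 1 ≤ last 0 (terms a b K)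
    1≤B = ≤-trans (≤-trans 1≤b b≤B) (≤-reflexive (sym last≡))
    to : InV a b x → P x
    to (k , x∈) with ≤-total k K
    ... | inj₁ k≤K = proj₁ (sound (∈-terms-mono k≤K x∈))
    ... | inj₂ K≤k = proj₁ (sound (∈-terms-later K≤k 1≤B x∈ (subst (x ≤_) (sym last≡) x≤B)))
    from : P x → InV a b x
    from Px = K , complete (Px , x≤B)

≤-witness : ∀ {m n} k → m + k ≡ n → m ≤ n
≤-witness {m} k refl = m≤m+n m k

shift-absurd : ∀ {A B : ℕ} → A ≡ B → ∀ X K → X + suc K ≡ A → B ≡ X → ⊥
shift-absurd A≡B X K lhs rhs = m+1+n≢m X (trans lhs (trans A≡B rhs))

parity-absurd : ∀ {A B : ℕ} → A ≡ B → ∀ P Q → 2 * P ≡ A → B ≡ 1 + 2 * Q → ⊥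
parity-absurd A≡B P Q lhs rhs = even≢odd P Q (trans lhs (trans A≡B rhs))

≡-through : ∀ {A B X Y : ℕ} → A ≡ B → X ≡ A → B ≡ Y → X ≡ Y
≡-through A≡B X≡A B≡Y = trans X≡A (trans A≡B B≡Y)

-- Opaque: these witnesses are computed with _∸_, and letting the unifier unfold them on the
-- large symbolic numbers below is prohibitively expensive.
opaque
  ≤-offset : ∀ {m n} → m ≤ n → ∃ λ k → m + k ≡ n
  ≤-offset m≤n = m≤n⇒∃[o]m+o≡n m≤n

  gap-offset : ∀ {p y} k → p < y → y < k + p → ∃ λ i → y ≡ suc i + p × suc i < k
  gap-offset {p} k p<y y<k+p with ≤-offset p<y
  ... | i , refl = i , y≡ , +-cancelʳ-< p (suc i) k (subst (_< k + p) y≡ y<k+p)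
    where
    y≡ : suc p + i ≡ suc i + p
    y≡ = cong suc (+-comm p i)

Odd : ℕ → Set
Odd x = ∃ λ k → x ≡ 1 + 2 * k

PrefixSet : ℕ → ℕ → Set
PrefixSet n x =
  x ≡ 2
  ⊎ (∃ λ k → x ≡ n + 2 * k × x + 1 ≤ 2 * n)
  ⊎ x ≡ 2 * n
  ⊎ (∃ λ k → x ≡ 2 * n + 1 + 2 * k × x + 2 ≤ 3 * n)
  ⊎ (∃ λ k → x ≡ 3 * n + 2 + 4 * k × x + 4 ≤ 5 * n)
  ⊎ x ≡ 5 * n + 2

-- With n = 5 + 2e the constructors are 2, the odd numbers n + 2a ≤ 3n - 2, 2n,
-- the numbers 3n + 2 + 4b ≤ 5n - 4, and 5n + 2.
module Prefix (e : ℕ) where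

  data V : ℕ → Set where
    two : V 2
    odd : ∀ a {d} → a + d ≡ 4 + 2 * e → V (5 + 2 * e + 2 * a)
    twice : V (10 + 4 * e)
    step4 : ∀ b {d} → b + d ≡ 1 + e → V (17 + 6 * e + 4 * b)
    top : V (27 + 10 * e)

  V-classes : ∀ {u} → V u → u ≡ 2 ⊎ u ≡ 10 + 4 * e ⊎ Odd u
  V-classes two = inj₁ refl
  V-classes (odd a _) = inj₂ (inj₂ (2 + e + a , solve (e ∷ a ∷ [])))
  V-classes twice = inj₂ (inj₁ refl)
  V-classes (step4 b _) = inj₂ (inj₂ (8 + 3 * e + 2 * b , solve (e ∷ b ∷ [])))
  V-classes top = inj₂ (inj₂ (13 + 5 * e , solve (e ∷ [])))

  n≤V : ∀ {u} → V u → u ≢ 2 → 5 + 2 * e ≤ u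
  n≤V two u≢2 = ⊥-elim (u≢2 refl)
  n≤V (odd a _) _ = m≤m+n _ _
  n≤V twice _ = ≤-witness (5 + 2 * e) (solve (e ∷ []))
  n≤V (step4 b _) _ = ≤-witness (12 + 4 * e + 4 * b) (solve (e ∷ b ∷ []))
  n≤V top _ = ≤-witness (22 + 8 * e) (solve (e ∷ []))

  V<n⇒≡2 : ∀ {u} → V u → u < 5 + 2 * e → u ≡ 2
  V<n⇒≡2 {u} Vu u<n with u ≟ 2
  ... | yes u≡2 = u≡2
  ... | no u≢2 = ⊥-elim (<⇒≱ u<n (n≤V Vu u≢2))

  odd≤3n-2 : ∀ a {d} → a + d ≡ 4 + 2 * e → 5 + 2 * e + 2 * a ≤ 5 + 2 * e + 2 * (4 + 2 * e)
  odd≤3n-2 a {d} a+d≡ = +-monoʳ-≤ (5 + 2 * e) (*-monoʳ-≤ 2 (subst (a ≤_) a+d≡ (m≤m+n a d)))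

  V-n : V (5 + 2 * e)
  V-n = subst V (+-identityʳ _) (odd 0 refl)

  2≤V : ∀ {u} → V u → 2 ≤ u
  2≤V two = ≤-refl
  2≤V (odd _ _) = s≤s (s≤s z≤n)
  2≤V twice = s≤s (s≤s z≤n)
  2≤V (step4 _ _) = s≤s (s≤s z≤n)
  2≤V top = s≤s (s≤s z≤n)

  odd-sum : ∀ {u v} → V u → V v → Odd (u + v) → (u ≡ 2 ⊎ u ≡ 10 + 4 * e) ⊎ (v ≡ 2 ⊎ v ≡ 10 + 4 * e)
  odd-sum Vu Vv (k , u+v≡) with V-classes Vu | V-classes Vv
  ... | inj₁ u≡2 | _ = inj₁ (inj₁ u≡2)
  ... | inj₂ (inj₁ u≡2n) | _ = inj₁ (inj₂ u≡2n)
  ... | inj₂ (inj₂ _) | inj₁ v≡2 = inj₂ (inj₁ v≡2)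
  ... | inj₂ (inj₂ _) | inj₂ (inj₁ v≡2n) = inj₂ (inj₂ v≡2n)
  ... | inj₂ (inj₂ (i , refl)) | inj₂ (inj₂ (j , refl)) =
    ⊥-elim (parity-absurd u+v≡ (1 + i + j) k (solve (i ∷ j ∷ [])) refl)

  no-rep-2+V-even-below-2n : ∀ {w k} → V w → 2 + w ≡ 2 * k → 2 < k → k < 5 + 2 * e → ⊥
  no-rep-2+V-even-below-2n {k = k} Vw 2+w≡2k 2<k k<n with V-classes Vw
  ... | inj₁ refl = <-irrefl (*-cancelˡ-≡ 2 k 2 2+w≡2k) 2<k
  ... | inj₂ (inj₁ refl) =
    <⇒≱ k<n (subst (5 + 2 * e ≤_) (*-cancelˡ-≡ (6 + 2 * e) k 2 (≡-through 2+w≡2k (solve (e ∷ [])) refl)) (n≤1+n _))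
  ... | inj₂ (inj₂ (j , refl)) = parity-absurd (sym 2+w≡2k) k (1 + j) refl (solve (j ∷ []))

  no-rep-even-below-2n : ∀ {u v k} → V u → V v → u + v ≡ 2 * k → 2 < k → k < 5 + 2 * e → ⊥
  no-rep-even-below-2n {u} {v} {k} Vu Vv u+v≡2k 2<k k<n with u ≟ 2 | v ≟ 2
  ... | yes refl | _ = no-rep-2+V-even-below-2n Vv u+v≡2k 2<k k<n
  ... | no _ | yes refl = no-rep-2+V-even-below-2n Vu (trans (+-comm 2 u) u+v≡2k) 2<k k<n
  ... | no u≢2 | no v≢2 = <⇒≱ k<n (*-cancelˡ-≤ 2 2n≤2k)
    where
    2n≤2k : 2 * (5 + 2 * e) ≤ 2 * k
    2n≤2k = begin
      2 * (5 + 2 * e)           ≡⟨ solve (e ∷ []) ⟩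
      5 + 2 * e + (5 + 2 * e)   ≤⟨ +-mono-≤ (n≤V Vu u≢2) (n≤V Vv v≢2) ⟩
      u + v                     ≡⟨ u+v≡2k ⟩
      2 * k                     ∎
      where open ≤-Reasoning

  3n≡2n+n : 15 + 6 * e ≡ 10 + 4 * e + (5 + 2 * e)
  3n≡2n+n = solve (e ∷ [])

  odd-below-3n-uses-2 : ∀ {u v} → V u → V v → Odd (u + v) → u + v < 15 + 6 * e → u ≡ 2 ⊎ v ≡ 2
  odd-below-3n-uses-2 {u} {v} Vu Vv odd-u+v u+v<3n with odd-sum Vu Vv odd-u+v
  ... | inj₁ (inj₁ u≡2) = inj₁ u≡2
  ... | inj₂ (inj₁ v≡2) = inj₂ v≡2
  ... | inj₁ (inj₂ refl) = inj₂ (V<n⇒≡2 Vv (+-cancelˡ-< (10 + 4 * e) v (5 + 2 * e) (subst (10 + 4 * e + v <_) 3n≡2n+n u+v<3n)))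
  ... | inj₂ (inj₂ refl) = inj₁ (V<n⇒≡2 Vu (+-cancelˡ-< (10 + 4 * e) u (5 + 2 * e) (subst₂ _<_ (+-comm u _) 3n≡2n+n u+v<3n)))

  odd-above-uses-2n : ∀ {c u v} → Below V c u → Below V c v → Odd (u + v) → 3 + c ≤ u + v →
    u ≡ 10 + 4 * e ⊎ v ≡ 10 + 4 * e
  odd-above-uses-2n {c} {u} {v} (Vu , u≤c) (Vv , v≤c) odd-u+v 3+c≤u+v with odd-sum Vu Vv odd-u+v
  ... | inj₁ (inj₂ u≡2n) = inj₁ u≡2n
  ... | inj₂ (inj₂ v≡2n) = inj₂ v≡2n
  ... | inj₁ (inj₁ refl) = ⊥-elim (<⇒≱ (+-cancelˡ-≤ 2 (1 + c) v 3+c≤u+v) v≤c)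
  ... | inj₂ (inj₁ refl) = ⊥-elim (<⇒≱ (+-cancelˡ-≤ 2 (1 + c) u (subst (3 + c ≤_) (+-comm u 2) 3+c≤u+v)) u≤c)

  2+V≢2n : ∀ {w} → V w → 2 + w ≢ 10 + 4 * e
  2+V≢2n Vw 2+w≡2n with V-classes Vw
  ... | inj₁ refl = shift-absurd (sym 2+w≡2n) 4 (5 + 4 * e) (solve (e ∷ [])) refl
  ... | inj₂ (inj₁ refl) = shift-absurd 2+w≡2n (10 + 4 * e) 1 (solve (e ∷ [])) refl
  ... | inj₂ (inj₂ (j , refl)) = parity-absurd (sym 2+w≡2n) (5 + 2 * e) (1 + j) (solve (e ∷ [])) (solve (j ∷ []))

  2n-only-n+n : ∀ {u v} → V u → V v → u + v ≡ 10 + 4 * e → u ≡ 5 + 2 * e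
  2n-only-n+n {u} {v} Vu Vv u+v≡2n with u ≟ 2 | v ≟ 2
  ... | yes refl | _ = ⊥-elim (2+V≢2n Vv u+v≡2n)
  ... | no _ | yes refl = ⊥-elim (2+V≢2n Vu (trans (+-comm 2 u) u+v≡2n))
  ... | no u≢2 | no v≢2 = ≤-antisym u≤n (n≤V Vu u≢2)
    where
    u≤n : u ≤ 5 + 2 * e
    u≤n = +-cancelʳ-≤ (5 + 2 * e) u (5 + 2 * e) (begin
      u + (5 + 2 * e)           ≤⟨ +-monoʳ-≤ u (n≤V Vv v≢2) ⟩
      u + v                     ≡⟨ u+v≡2n ⟩
      10 + 4 * e                ≡⟨ solve (e ∷ []) ⟩
      5 + 2 * e + (5 + 2 * e)   ∎)
      where open ≤-Reasoning

  V≢3n : ∀ {z} → V z → z ≢ 15 + 6 * e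
  V≢3n two z≡3n = shift-absurd (sym z≡3n) 2 (12 + 6 * e) (solve (e ∷ [])) refl
  V≢3n (odd a {d} eq) z≡3n =
    shift-absurd (cong₂ _+_ (sym z≡3n) (cong (2 *_) eq)) (13 + 6 * e + 2 * a) (1 + 2 * d)
      (solve (e ∷ a ∷ d ∷ [])) (solve (e ∷ a ∷ []))
  V≢3n twice z≡3n = shift-absurd (sym z≡3n) (10 + 4 * e) (4 + 2 * e) (solve (e ∷ [])) refl
  V≢3n (step4 b _) z≡3n = shift-absurd z≡3n (15 + 6 * e) (1 + 4 * b) (solve (e ∷ b ∷ [])) refl
  V≢3n top z≡3n = shift-absurd z≡3n (15 + 6 * e) (11 + 4 * e) (solve (e ∷ [])) refl

  -- Opaque, so that the solver proof is not unfolded in the with-abstraction of no-rep-5n.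
  opaque
    5n-odd : Odd (25 + 10 * e)
    5n-odd = 12 + 5 * e , solve (e ∷ [])

  no-rep-5n : ∀ {u v} → Below V (21 + 10 * e) u → Below V (21 + 10 * e) v → u + v ≢ 25 + 10 * e
  no-rep-5n {u} {v} (Vu , u≤) (Vv , v≤) u+v≡5n with odd-sum Vu Vv (subst Odd (sym u+v≡5n) 5n-odd)
  ... | inj₁ (inj₁ refl) =
    <⇒≱ (≤-witness 1 (+-cancelˡ-≡ 2 (22 + 10 * e + 1) v (≡-through (sym u+v≡5n) (solve (e ∷ [])) refl))) v≤
  ... | inj₂ (inj₁ refl) =
    <⇒≱ (≤-witness 1 (+-cancelˡ-≡ 2 (22 + 10 * e + 1) u (≡-through (sym u+v≡5n) (solve (e ∷ [])) (+-comm u 2)))) u≤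
  ... | inj₁ (inj₂ refl) = V≢3n Vv (+-cancelˡ-≡ (10 + 4 * e) v (15 + 6 * e) (≡-through u+v≡5n refl (solve (e ∷ []))))
  ... | inj₂ (inj₂ refl) = V≢3n Vu (+-cancelʳ-≡ (10 + 4 * e) u (15 + 6 * e) (≡-through u+v≡5n refl (solve (e ∷ []))))

  -- An even y = 2n + 2i has the two representations n + (y - n) and (n + 2) + (y - n - 2)
  -- when i < n, and (n + 2 + 2j) + (3n - 2), (n + 4 + 2j) + (3n - 4) when i = n + j.
  module _ {L p} (E : Enumerates V L p) where

    private
      odd-below : ∀ {y} → y ≤ 5 + 2 * e + p → ∀ a {d} → a + d ≡ 4 + 2 * e →
        5 + 2 * e + (5 + 2 * e + 2 * a) ≤ y → Below V p (5 + 2 * e + 2 * a)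
      odd-below y≤n+p a eq n+x≤y = odd a eq , +-cancelˡ-≤ (5 + 2 * e) _ _ (≤-trans n+x≤y y≤n+p)

    even-two-reps : ∀ i → 2 ≤ i → i + 2 ≤ 8 + 4 * e → ∀ {y} → 10 + 4 * e + 2 * i ≡ y → y ≤ 5 + 2 * e + p →
      uniqueRep L y ≡ false
    even-two-reps i 2≤i i+2≤ refl y≤n+p with i ≤? 4 + 2 * e | ≤-offset 2≤i
    ... | yes i≤n-1 | j , refl with ≤-offset i≤n-1
    ... | d , i+d≡ =
      uniqueRep-two E (odd-below y≤n+p 0 refl (≤-witness (2 * (2 + j)) (solve (e ∷ j ∷ []))))
                      (odd-below y≤n+p (2 + j) i+d≡ (≤-witness 0 (solve (e ∷ j ∷ []))))
                      (odd-below y≤n+p 1 refl (≤-witness (2 * (1 + j)) (solve (e ∷ j ∷ []))))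
                      (odd-below y≤n+p (1 + j) {suc d} (≡-through i+d≡ (solve (j ∷ d ∷ [])) refl)
                        (≤-witness 2 (solve (e ∷ j ∷ []))))
                      (solve (e ∷ j ∷ [])) (solve (e ∷ j ∷ []))
                      (≤-witness 1 (solve (e ∷ []))) (≤-witness (1 + 2 * j) (solve (e ∷ j ∷ [])))
    even-two-reps i 2≤i i+2≤ refl y≤n+p | no i≰n-1 | _ with ≤-offset (≰⇒> i≰n-1) | ≤-offset i+2≤
    ... | j , refl | k , i+2+k≡ =
      uniqueRep-two E (odd-below y≤n+p (1 + j) {2 + k} (≡-through j+k≡ (solve (j ∷ k ∷ [])) refl)
                        (≤-witness (2 * (4 + 2 * e)) (solve (e ∷ j ∷ []))))
                      (odd-below y≤n+p (4 + 2 * e) (+-identityʳ _) (≤-witness (2 * (1 + j)) (solve (e ∷ j ∷ []))))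
                      (odd-below y≤n+p (2 + j) {1 + k} (≡-through j+k≡ (solve (j ∷ k ∷ [])) refl)
                        (≤-witness (2 * (3 + 2 * e)) (solve (e ∷ j ∷ []))))
                      (odd-below y≤n+p (3 + 2 * e) {1} (solve (e ∷ [])) (≤-witness (2 * (2 + j)) (solve (e ∷ j ∷ []))))
                      (solve (e ∷ j ∷ [])) (solve (e ∷ j ∷ []))
                      (≤-witness 1 (solve (e ∷ j ∷ [])))
                      (≤-witness (1 + 2 * k)
                        (≡-through (cong (λ t → 3 + 2 * e + 2 * t) j+k≡) (solve (e ∷ j ∷ k ∷ [])) (solve (e ∷ []))))
      where
      j+k≡ : 3 + j + k ≡ 4 + 2 * e
      j+k≡ = +-cancelˡ-≡ (4 + 2 * e) (3 + j + k) (4 + 2 * e) (≡-through i+2+k≡ (solve (e ∷ j ∷ k ∷ [])) (solve (e ∷ [])))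

    unique-2+w : ∀ {w y} → Below V p w → 2 + w ≡ y → Odd y → y < 15 + 6 * e → uniqueRep L y ≡ true
    unique-2+w {w} {y} (Vw , w≤p) 2+w≡y odd-y y<3n =
      uniqueRep-one E (two , ≤-trans (2≤V Vw) w≤p) (Vw , w≤p) 2+w≡y only
      where
      only : ∀ {u v} → Below V p u → Below V p v → u + v ≡ y → u ≡ 2 ⊎ u ≡ w
      only {u} {v} (Vu , _) (Vv , _) u+v≡y
        with odd-below-3n-uses-2 Vu Vv (subst Odd (sym u+v≡y) odd-y) (subst (_< 15 + 6 * e) (sym u+v≡y) y<3n)
      ... | inj₁ u≡2 = inj₁ u≡2
      ... | inj₂ refl = inj₂ (+-cancelʳ-≡ 2 u w (trans u+v≡y (trans (sym 2+w≡y) (+-comm 2 w))))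

    unique-w+2n : ∀ {w y} → Below V p w → 10 + 4 * e ≤ p → w + (10 + 4 * e) ≡ y → Odd y → 3 + p ≤ y →
      uniqueRep L y ≡ true
    unique-w+2n {w} {y} w∈ 2n≤p w+2n≡y odd-y 3+p≤y = uniqueRep-one E w∈ (twice , 2n≤p) w+2n≡y only
      where
      only : ∀ {u v} → Below V p u → Below V p v → u + v ≡ y → u ≡ w ⊎ u ≡ 10 + 4 * e
      only {u} {v} u∈ v∈ u+v≡y
        with odd-above-uses-2n u∈ v∈ (subst Odd (sym u+v≡y) odd-y) (subst (3 + p ≤_) (sym u+v≡y) 3+p≤y)
      ... | inj₁ u≡2n = inj₂ u≡2n
      ... | inj₂ refl = inj₁ (+-cancelʳ-≡ (10 + 4 * e) u w (trans u+v≡y (sym w+2n≡y)))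

  next-after-odd : ∀ {p z} → Odd p → suc p ≢ 2 → suc p ≢ 10 + 4 * e → V z → p < z → 2 + p ≤ z
  next-after-odd {p} {z} (i , refl) p+1≢2 p+1≢2n Vz p<z with z ≟ suc p
  ... | no z≢p+1 = ≤∧≢⇒< p<z (z≢p+1 ∘ sym)
  ... | yes refl with V-classes Vz
  ...   | inj₁ z≡2 = ⊥-elim (p+1≢2 z≡2)
  ...   | inj₂ (inj₁ z≡2n) = ⊥-elim (p+1≢2n z≡2n)
  ...   | inj₂ (inj₂ (j , z≡)) = ⊥-elim (parity-absurd z≡ (1 + i) j (solve (i ∷ [])) refl)

  -- Inside the odd block the gap p + 1 is even: below 2n it has no representation, just above
  -- it is 2 + 2n = n + (n + 2), and further up it has two representations inside the block.
  successor-odd : ∀ a {d} → a + suc d ≡ 4 + 2 * e → a ≢ 2 + e → Successor V (5 + 2 * e + 2 * a)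
  successor-odd a {d} a+d+1≡ a≢2+e = record
    { next = 2 + (5 + 2 * e + 2 * a)
    ; P-next = subst V next≡ (odd (suc a) {d} (trans (sym (+-suc a d)) a+d+1≡))
    ; p<next = m<n+m (5 + 2 * e + 2 * a) {2} (s≤s z≤n)
    ; next≤p+p = +-monoˡ-≤ (5 + 2 * e + 2 * a) {2} {5 + 2 * e + 2 * a} (s≤s (s≤s z≤n))
    ; next-least = next-after-odd {5 + 2 * e + 2 * a} (2 + e + a , solve (e ∷ a ∷ [])) (λ ()) p+1≢2n
    ; skipped = skipped
    ; chosen = λ E → unique-2+w E (odd a a+d+1≡ , ≤-refl) refl (3 + e + a , solve (e ∷ a ∷ [])) next<3n
    }
    where
    next≡ : 5 + 2 * e + 2 * suc a ≡ 2 + (5 + 2 * e + 2 * a)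
    next≡ = solve (e ∷ a ∷ [])
    p+1≢2n : suc (5 + 2 * e + 2 * a) ≢ 10 + 4 * e
    p+1≢2n p+1≡2n =
      a≢2+e (*-cancelˡ-≡ a (2 + e) 2 (+-cancelˡ-≡ (6 + 2 * e) (2 * a) (2 * (2 + e)) (≡-through p+1≡2n refl (solve (e ∷ [])))))
    next<3n : 2 + (5 + 2 * e + 2 * a) < 15 + 6 * e
    next<3n = ≤-witness (1 + 2 * d)
      (≡-through (cong (λ t → 7 + 2 * e + 2 * t) a+d+1≡) (solve (e ∷ a ∷ d ∷ [])) (solve (e ∷ [])))
    3+e+[2+e]≡n : 3 + e + (2 + e) ≡ 5 + 2 * e
    3+e+[2+e]≡n = solve (e ∷ [])
    skipped : ∀ {L} → Enumerates V L (5 + 2 * e + 2 * a) → ∀ {y} →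
      5 + 2 * e + 2 * a < y → y < 2 + (5 + 2 * e + 2 * a) → uniqueRep L y ≡ false
    skipped E p<y y<next with gap-offset 2 p<y y<next
    ... | suc _ , _ , s≤s (s≤s ())
    ... | 0 , refl , _ with <-cmp a (2 + e)
    ...   | tri< a<2+e _ _ = uniqueRep-none E λ (Vu , _) (Vv , _) u+v≡ →
              no-rep-even-below-2n {k = 3 + e + a} Vu Vv (trans u+v≡ (solve (e ∷ a ∷ []))) (s≤s (s≤s (s≤s z≤n)))
                (subst (3 + e + a <_) (3+e+[2+e]≡n) (+-monoʳ-< (3 + e) a<2+e))
    ...   | tri≈ _ a≡2+e _ = ⊥-elim (a≢2+e a≡2+e)
    ...   | tri> _ _ a>2+e with ≤-offset a>2+e
    ...     | 0 , refl =
              uniqueRep-two E (two , s≤s (s≤s z≤n)) (twice , ≤-witness 1 (solve (e ∷ [])))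
                (odd 0 refl , ≤-witness (2 * (3 + e)) (solve (e ∷ []))) (odd 1 refl , ≤-witness (2 * (2 + e)) (solve (e ∷ [])))
                (solve (e ∷ [])) (solve (e ∷ [])) (s≤s (s≤s (s≤s z≤n))) (s≤s (s≤s (s≤s z≤n)))
    ...     | suc j , refl =
              even-two-reps E (2 + j) (s≤s (s≤s z≤n))
                (≤-witness (5 + 3 * e + d) (≡-through (cong (4 + 2 * e +_) a+d+1≡) (solve (e ∷ j ∷ d ∷ [])) (solve (e ∷ []))))
                (solve (e ∷ j ∷ [])) (≤-witness (4 + 2 * e) (solve (e ∷ j ∷ [])))

  successor-2n-1 : Successor V (5 + 2 * e + 2 * (2 + e))
  successor-2n-1 = record
    { next = 1 + (5 + 2 * e + 2 * (2 + e))
    ; P-next = subst V 2n≡ twice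
    ; p<next = ≤-refl
    ; next≤p+p = +-monoˡ-≤ (5 + 2 * e + 2 * (2 + e)) {1} {5 + 2 * e + 2 * (2 + e)} (s≤s z≤n)
    ; next-least = λ _ p<z → p<z
    ; skipped = λ _ p<y y<next → ⊥-elim (<⇒≱ p<y (≤-pred y<next))
    ; chosen = λ E → uniqueRep-one E n∈ n∈ (≡-through 2n≡ (solve (e ∷ [])) refl) λ (Vu , _) (Vv , _) u+v≡ →
        inj₁ (2n-only-n+n Vu Vv (trans u+v≡ (sym 2n≡)))
    }
    where
    2n≡ : 10 + 4 * e ≡ 1 + (5 + 2 * e + 2 * (2 + e))
    2n≡ = solve (e ∷ [])
    n∈ : Below V (5 + 2 * e + 2 * (2 + e)) (5 + 2 * e)
    n∈ = V-n , m≤m+n _ _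

  successor-2n : Successor V (10 + 4 * e)
  successor-2n = record
    { next = 1 + (10 + 4 * e)
    ; P-next = subst V 2n+1≡ (odd (3 + e) {1 + e} (solve (e ∷ [])))
    ; p<next = ≤-refl
    ; next≤p+p = +-monoˡ-≤ (10 + 4 * e) {1} {10 + 4 * e} (s≤s z≤n)
    ; next-least = λ _ p<z → p<z
    ; skipped = λ _ p<y y<next → ⊥-elim (<⇒≱ p<y (≤-pred y<next))
    ; chosen = λ E → unique-2+w E (odd (2 + e) {2 + e} (solve (e ∷ [])) , ≤-witness 1 (solve (e ∷ [])))
                       (solve (e ∷ [])) (5 + 2 * e , solve (e ∷ [])) (≤-witness (3 + 2 * e) (solve (e ∷ [])))
    }
    where
    2n+1≡ : 5 + 2 * e + 2 * (3 + e) ≡ 1 + (10 + 4 * e)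
    2n+1≡ = solve (e ∷ [])

  successor-3n-2 : Successor V (5 + 2 * e + 2 * (4 + 2 * e))
  successor-3n-2 = record
    { next = 4 + (5 + 2 * e + 2 * (4 + 2 * e))
    ; P-next = subst V 3n+2≡ (step4 0 {1 + e} refl)
    ; p<next = m<n+m (5 + 2 * e + 2 * (4 + 2 * e)) {4} (s≤s z≤n)
    ; next≤p+p = +-monoˡ-≤ (5 + 2 * e + 2 * (4 + 2 * e)) {4} {5 + 2 * e + 2 * (4 + 2 * e)} (s≤s (s≤s (s≤s (s≤s z≤n))))
    ; next-least = least
    ; skipped = skipped
    ; chosen = λ E → unique-w+2n E (odd 1 {3 + 2 * e} refl , ≤-witness (2 * (3 + 2 * e)) (solve (e ∷ [])))
                       (≤-witness (3 + 2 * e) (solve (e ∷ []))) (≡-through 3n+2≡ (solve (e ∷ [])) refl)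
                       (8 + 3 * e , solve (e ∷ [])) (n≤1+n _)
    }
    where
    3n+2≡ : 17 + 6 * e + 4 * 0 ≡ 4 + (5 + 2 * e + 2 * (4 + 2 * e))
    3n+2≡ = solve (e ∷ [])
    least : ∀ {z} → V z → 5 + 2 * e + 2 * (4 + 2 * e) < z → 4 + (5 + 2 * e + 2 * (4 + 2 * e)) ≤ z
    least two p<2 = ⊥-elim (<⇒≱ p<2 (s≤s (s≤s z≤n)))
    least (odd a a+d≡) p<z = ⊥-elim (<⇒≱ p<z (odd≤3n-2 a a+d≡))
    least twice p<2n = ⊥-elim (<⇒≱ p<2n (≤-witness (3 + 2 * e) (solve (e ∷ []))))
    least (step4 b _) _ = ≤-witness (4 * b) (solve (e ∷ b ∷ []))
    least top _ = ≤-witness (10 + 4 * e) (solve (e ∷ []))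
    skipped : ∀ {L} → Enumerates V L (5 + 2 * e + 2 * (4 + 2 * e)) → ∀ {y} →
      5 + 2 * e + 2 * (4 + 2 * e) < y → y < 4 + (5 + 2 * e + 2 * (4 + 2 * e)) → uniqueRep L y ≡ false
    skipped E p<y y<next with gap-offset 4 p<y y<next
    ... | 0 , refl , _ = even-two-reps E (2 + e) (s≤s (s≤s z≤n)) (≤-witness (4 + 3 * e) (solve (e ∷ [])))
                           (solve (e ∷ [])) (≤-witness (4 + 2 * e) (solve (e ∷ [])))
    ... | 1 , refl , _ = uniqueRep-two E (two , s≤s (s≤s z≤n)) (odd (4 + 2 * e) (+-identityʳ _) , ≤-refl)
                           (V-n , ≤-witness (2 * (4 + 2 * e)) (solve (e ∷ []))) (twice , ≤-witness (3 + 2 * e) (solve (e ∷ [])))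
                           refl (solve (e ∷ [])) (s≤s (s≤s (s≤s z≤n))) (s≤s (s≤s (s≤s z≤n)))
    ... | 2 , refl , _ = even-two-reps E (3 + e) (s≤s (s≤s z≤n)) (≤-witness (3 + 3 * e) (solve (e ∷ [])))
                           (solve (e ∷ [])) (≤-witness (2 + 2 * e) (solve (e ∷ [])))
    ... | suc (suc (suc _)) , _ , s≤s (s≤s (s≤s (s≤s ())))

  successor-step4 : ∀ b {d} → b + suc d ≡ 1 + e → Successor V (17 + 6 * e + 4 * b)
  successor-step4 b {d} b+d+1≡ = record
    { next = 4 + (17 + 6 * e + 4 * b)
    ; P-next = subst V next≡ (step4 (suc b) {d} (trans (sym (+-suc b d)) b+d+1≡))
    ; p<next = m<n+m (17 + 6 * e + 4 * b) {4} (s≤s z≤n)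
    ; next≤p+p = +-monoˡ-≤ (17 + 6 * e + 4 * b) {4} {17 + 6 * e + 4 * b} (s≤s (s≤s (s≤s (s≤s z≤n))))
    ; next-least = least
    ; skipped = skipped
    ; chosen = λ E → unique-w+2n E
                       (odd (3 + 2 * b) {1 + 2 * d} (≡-through (cong (λ t → 2 + 2 * t) b+d+1≡) (solve (b ∷ d ∷ [])) (solve (e ∷ [])))
                                      , ≤-witness (6 + 4 * e) (solve (e ∷ b ∷ [])))
                       2n≤p (solve (e ∷ b ∷ [])) (10 + 3 * e + 2 * b , solve (e ∷ b ∷ [])) (n≤1+n _)
    }
    where
    next≡ : 17 + 6 * e + 4 * suc b ≡ 4 + (17 + 6 * e + 4 * b)
    next≡ = solve (e ∷ b ∷ [])
    2n≤p : 10 + 4 * e ≤ 17 + 6 * e + 4 * b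
    2n≤p = ≤-witness (7 + 2 * e + 4 * b) (solve (e ∷ b ∷ []))
    b+d≡e : b + d ≡ e
    b+d≡e = suc-injective (trans (sym (+-suc b d)) b+d+1≡)
    least : ∀ {z} → V z → 17 + 6 * e + 4 * b < z → 4 + (17 + 6 * e + 4 * b) ≤ z
    least two p<2 = ⊥-elim (<⇒≱ p<2 (s≤s (s≤s z≤n)))
    least (odd a a+d≡) p<z = ⊥-elim (<⇒≱ p<z (≤-trans (odd≤3n-2 a a+d≡) (≤-witness (4 + 4 * b) (solve (e ∷ b ∷ [])))))
    least twice p<2n = ⊥-elim (<⇒≱ p<2n 2n≤p)
    least (step4 b′ _) p<z = subst (_≤ 17 + 6 * e + 4 * b′) next≡
      (+-monoʳ-≤ (17 + 6 * e) (*-monoʳ-≤ 4 (*-cancelˡ-< 4 b b′ (+-cancelˡ-< (17 + 6 * e) (4 * b) (4 * b′) p<z))))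
    least top _ = ≤-witness (6 + 4 * d) (≡-through (cong (λ t → 27 + 6 * e + 4 * t) b+d≡e) (solve (e ∷ b ∷ d ∷ [])) (solve (e ∷ [])))
    skipped : ∀ {L} → Enumerates V L (17 + 6 * e + 4 * b) → ∀ {y} →
      17 + 6 * e + 4 * b < y → y < 4 + (17 + 6 * e + 4 * b) → uniqueRep L y ≡ false
    skipped E p<y y<next with gap-offset 4 p<y y<next
    ... | 0 , refl , _ = even-two-reps E (4 + e + 2 * b) (s≤s (s≤s z≤n))
                           (≤-witness (2 + e + 2 * d)
                             (≡-through (cong (λ t → 8 + 2 * e + 2 * t) b+d≡e) (solve (e ∷ b ∷ d ∷ [])) (solve (e ∷ []))))
                           (solve (e ∷ b ∷ [])) (≤-witness (4 + 2 * e) (solve (e ∷ b ∷ [])))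
    ... | 1 , refl , _ = uniqueRep-two E (two , s≤s (s≤s z≤n)) (step4 b b+d+1≡ , ≤-refl)
                           (odd (2 + 2 * b) {2 + 2 * d} (≡-through (cong (λ t → 4 + 2 * t) b+d≡e) (solve (b ∷ d ∷ [])) (solve (e ∷ []))) ,
                              ≤-witness (8 + 4 * e) (solve (e ∷ b ∷ [])))
                           (twice , 2n≤p) refl (solve (e ∷ b ∷ [])) (s≤s (s≤s (s≤s z≤n))) (s≤s (s≤s (s≤s z≤n)))
    ... | 2 , refl , _ = even-two-reps E (5 + e + 2 * b) (s≤s (s≤s z≤n))
                           (≤-witness (1 + e + 2 * d)
                             (≡-through (cong (λ t → 8 + 2 * e + 2 * t) b+d≡e) (solve (e ∷ b ∷ d ∷ [])) (solve (e ∷ []))))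
                           (solve (e ∷ b ∷ [])) (≤-witness (2 + 2 * e) (solve (e ∷ b ∷ [])))
    ... | suc (suc (suc _)) , _ , s≤s (s≤s (s≤s (s≤s ())))

  successor-5n-4 : Successor V (21 + 10 * e)
  successor-5n-4 = record
    { next = 6 + (21 + 10 * e)
    ; P-next = top
    ; p<next = m<n+m (21 + 10 * e) {6} (s≤s z≤n)
    ; next≤p+p = +-monoˡ-≤ (21 + 10 * e) {6} {21 + 10 * e} (s≤s (s≤s (s≤s (s≤s (s≤s (s≤s z≤n))))))
    ; next-least = least
    ; skipped = skipped
    ; chosen = λ E → unique-w+2n E 3n+2∈ 2n≤p (solve (e ∷ [])) (13 + 5 * e , solve (e ∷ []))
                       (+-monoˡ-≤ (21 + 10 * e) {3} {6} (s≤s (s≤s (s≤s z≤n))))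
    }
    where
    2n≤p : 10 + 4 * e ≤ 21 + 10 * e
    2n≤p = ≤-witness (11 + 6 * e) (solve (e ∷ []))
    3n-2≤p : 5 + 2 * e + 2 * (4 + 2 * e) ≤ 21 + 10 * e
    3n-2≤p = ≤-witness (8 + 4 * e) (solve (e ∷ []))
    odd∈ : ∀ a {d} → a + d ≡ 4 + 2 * e → Below V (21 + 10 * e) (5 + 2 * e + 2 * a)
    odd∈ a a+d≡ = odd a a+d≡ , ≤-trans (odd≤3n-2 a a+d≡) 3n-2≤p
    3n+2∈ : Below V (21 + 10 * e) (17 + 6 * e + 4 * 0)
    3n+2∈ = step4 0 {1 + e} refl , ≤-witness (4 + 4 * e) (solve (e ∷ []))
    least : ∀ {z} → V z → 21 + 10 * e < z → 6 + (21 + 10 * e) ≤ z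
    least two p<2 = ⊥-elim (<⇒≱ p<2 (s≤s (s≤s z≤n)))
    least (odd a a+d≡) p<z = ⊥-elim (<⇒≱ p<z (proj₂ (odd∈ a a+d≡)))
    least twice p<2n = ⊥-elim (<⇒≱ p<2n 2n≤p)
    least (step4 b {d} b+d≡) p<z =
      ⊥-elim (<⇒≱ p<z (≤-witness (4 * d)
        (≡-through (cong (λ t → 17 + 6 * e + 4 * t) b+d≡) (solve (e ∷ b ∷ d ∷ [])) (solve (e ∷ [])))))
    least top _ = ≤-refl
    skipped : ∀ {L} → Enumerates V L (21 + 10 * e) → ∀ {y} → 21 + 10 * e < y → y < 6 + (21 + 10 * e) → uniqueRep L y ≡ false
    skipped E p<y y<next with gap-offset 6 p<y y<next
    ... | 0 , refl , _ = even-two-reps E (6 + 3 * e) (s≤s (s≤s z≤n)) (≤-witness e (solve (e ∷ [])))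
                           (solve (e ∷ [])) (≤-witness (4 + 2 * e) (solve (e ∷ [])))
    ... | 1 , refl , _ = uniqueRep-two E (two , s≤s (s≤s z≤n)) (step4 (1 + e) {0} (+-identityʳ _) , ≤-witness 0 (solve (e ∷ [])))
                           (twice , 2n≤p) (odd∈ (4 + 2 * e) (+-identityʳ _))
                           (solve (e ∷ [])) (solve (e ∷ [])) (s≤s (s≤s (s≤s z≤n))) (s≤s (s≤s (s≤s z≤n)))
    ... | 2 , refl , _ = uniqueRep-two E (odd∈ (1 + e) {3 + e} (solve (e ∷ []))) 3n+2∈
                           (odd∈ (3 + e) {1 + e} (solve (e ∷ []))) (odd∈ (4 + 2 * e) (+-identityʳ _))
                           (solve (e ∷ [])) (solve (e ∷ [])) (≤-witness 3 (solve (e ∷ []))) (≤-witness (5 + 2 * e) (solve (e ∷ [])))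
    ... | 3 , refl , _ = uniqueRep-none E no-rep-5n
    ... | 4 , refl , _ = uniqueRep-two E (odd∈ (2 + e) {2 + e} (solve (e ∷ []))) 3n+2∈
                           (odd∈ (4 + e) {e} (solve (e ∷ []))) (odd∈ (4 + 2 * e) (+-identityʳ _))
                           (solve (e ∷ [])) (solve (e ∷ [])) (≤-witness 3 (solve (e ∷ []))) (≤-witness (3 + 2 * e) (solve (e ∷ [])))
    ... | suc (suc (suc (suc (suc _)))) , _ , s≤s (s≤s (s≤s (s≤s (s≤s (s≤s ())))))

  successor : ∀ {p} → V p → 5 + 2 * e ≤ p → p < 27 + 10 * e → Successor V p
  successor two (s≤s (s≤s ())) _
  successor (odd a {zero} a+0≡) _ _ with trans (sym (+-identityʳ a)) a+0≡
  ... | refl = successor-3n-2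
  successor (odd a {suc d} a+d+1≡) _ _ with a ≟ 2 + e
  ... | yes refl = successor-2n-1
  ... | no a≢2+e = successor-odd a a+d+1≡ a≢2+e
  successor twice _ _ = successor-2n
  successor (step4 b {zero} b+0≡) _ _ with trans (sym (+-identityʳ b)) b+0≡
  ... | refl = subst (Successor V) 5n-4≡ successor-5n-4
    where
    5n-4≡ : 21 + 10 * e ≡ 17 + 6 * e + 4 * (1 + e)
    5n-4≡ = solve (e ∷ [])
  successor (step4 b {suc d} b+d+1≡) _ _ = successor-step4 b b+d+1≡
  successor top _ p<p = ⊥-elim (<-irrefl refl p<p)

  initial : Enumerates V (terms 2 (5 + 2 * e) 0) (5 + 2 * e)
  initial = record
    { increasing = (s≤s (s≤s (s≤s z≤n)) All.∷ All.[]) AllPairs.∷ All.[] AllPairs.∷ AllPairs.[]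
    ; last≡ = refl
    ; sound = λ { (here refl) → two , s≤s (s≤s z≤n) ; (there (here refl)) → V-n , ≤-refl }
    ; complete = complete
    }
    where
    complete : ∀ {u} → Below V (5 + 2 * e) u → u ∈ terms 2 (5 + 2 * e) 0
    complete {u} (Vu , u≤n) with u ≟ 2
    ... | yes refl = here refl
    ... | no u≢2 = there (here (≤-antisym u≤n (n≤V Vu u≢2)))

  open Characterisation initial successor top (≤-witness (22 + 8 * e) (solve (e ∷ [])))

  V⇒PrefixSet : ∀ {x} → V x → PrefixSet (5 + 2 * e) x
  V⇒PrefixSet two = inj₁ refl
  V⇒PrefixSet (odd a {d} a+d≡) with a ≤? 2 + e
  ... | yes a≤2+e with ≤-offset a≤2+e
  ...   | j , a+j≡ = inj₂ (inj₁ (a , refl ,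
            ≤-witness (2 * j) (≡-through (cong (λ t → 6 + 2 * e + 2 * t) a+j≡) (solve (e ∷ a ∷ j ∷ [])) (solve (e ∷ [])))))
  V⇒PrefixSet (odd a {d} a+d≡) | no a≰2+e with ≤-offset (≰⇒> a≰2+e)
  ...   | k , refl = inj₂ (inj₂ (inj₂ (inj₁ (k , solve (e ∷ k ∷ []) ,
            ≤-witness (2 * d) (≡-through (cong (λ t → 7 + 2 * e + 2 * t) a+d≡) (solve (e ∷ k ∷ d ∷ [])) (solve (e ∷ [])))))))
  V⇒PrefixSet twice = inj₂ (inj₂ (inj₁ (solve (e ∷ []))))
  V⇒PrefixSet (step4 b {d} b+d≡) = inj₂ (inj₂ (inj₂ (inj₂ (inj₁ (b , solve (e ∷ b ∷ []) ,
            ≤-witness (4 * d) (≡-through (cong (λ t → 21 + 6 * e + 4 * t) b+d≡) (solve (e ∷ b ∷ d ∷ [])) (solve (e ∷ []))))))))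
  V⇒PrefixSet top = inj₂ (inj₂ (inj₂ (inj₂ (inj₂ (solve (e ∷ []))))))

  PrefixSet⇒V : ∀ {x} → PrefixSet (5 + 2 * e) x → V x
  PrefixSet⇒V (inj₁ refl) = two
  PrefixSet⇒V (inj₂ (inj₁ (k , refl , x+1≤2n))) with ≤-offset x+1≤2n
  ... | j , x+1+j≡ = odd k {k + j} (+-cancelˡ-≡ (6 + 2 * e) (k + (k + j)) (4 + 2 * e)
                       (≡-through x+1+j≡ (solve (e ∷ k ∷ j ∷ [])) (solve (e ∷ []))))
  PrefixSet⇒V (inj₂ (inj₂ (inj₁ refl))) = subst V {x = 10 + 4 * e} (solve (e ∷ [])) twice
  PrefixSet⇒V (inj₂ (inj₂ (inj₂ (inj₁ (k , refl , x+2≤3n))))) with k ≤? 1 + e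
  ... | yes k≤1+e with ≤-offset k≤1+e
  ...   | d , k+d≡ = subst V {x = 5 + 2 * e + 2 * (3 + e + k)} (solve (e ∷ k ∷ []))
                       (odd (3 + e + k) {d} (≡-through (cong (3 + e +_) k+d≡) (solve (e ∷ k ∷ d ∷ [])) (solve (e ∷ []))))
  PrefixSet⇒V (inj₂ (inj₂ (inj₂ (inj₁ (k , refl , x+2≤3n))))) | no k≰1+e with ≤-offset (≰⇒> k≰1+e) | ≤-offset x+2≤3n
  ...   | i , refl | j , x+2+j≡ = ⊥-elim (shift-absurd x+2+j≡ (15 + 6 * e) (1 + 2 * i + j) (solve (e ∷ i ∷ j ∷ [])) (solve (e ∷ [])))
  PrefixSet⇒V (inj₂ (inj₂ (inj₂ (inj₂ (inj₁ (k , refl , x+4≤5n)))))) with k ≤? 1 + e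
  ... | yes k≤1+e with ≤-offset k≤1+e
  ...   | d , k+d≡ = subst V {x = 17 + 6 * e + 4 * k} (solve (e ∷ k ∷ [])) (step4 k k+d≡)
  PrefixSet⇒V (inj₂ (inj₂ (inj₂ (inj₂ (inj₁ (k , refl , x+4≤5n)))))) | no k≰1+e with ≤-offset (≰⇒> k≰1+e) | ≤-offset x+4≤5n
  ...   | i , refl | j , x+4+j≡ = ⊥-elim (shift-absurd x+4+j≡ (25 + 10 * e) (3 + 4 * i + j) (solve (e ∷ i ∷ j ∷ [])) (solve (e ∷ [])))
  PrefixSet⇒V (inj₂ (inj₂ (inj₂ (inj₂ (inj₂ refl))))) = subst V {x = 27 + 10 * e} (solve (e ∷ [])) top

  InV⇔PrefixSet : ∀ {x} → x ≤ 27 + 10 * e → InV 2 (5 + 2 * e) x ⇔ PrefixSet (5 + 2 * e) x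
  InV⇔PrefixSet x≤ = ⇔-trans (InV⇔P x≤) (mk⇔ V⇒PrefixSet PrefixSet⇒V)

¬2∣⇒odd : ∀ {n} → ¬ (2 ∣ n) → Odd n
¬2∣⇒odd {zero} 2∤0 = ⊥-elim (2∤0 (divides 0 refl))
¬2∣⇒odd {suc zero} _ = 0 , refl
¬2∣⇒odd {suc (suc n)} 2∤n+2 with ¬2∣⇒odd {n} (2∤n+2 ∘ ∣m∣n⇒∣m+n (∣-refl {2}))
... | k , refl = suc k , cong suc (sym (*-suc 2 k))

odd≥5⇒≡5+2e : ∀ {n} → 5 ≤ n → ¬ (2 ∣ n) → ∃ λ e → n ≡ 5 + 2 * e
odd≥5⇒≡5+2e 5≤n 2∤n with ¬2∣⇒odd 2∤n
odd≥5⇒≡5+2e (s≤s ()) _ | 0 , refl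
odd≥5⇒≡5+2e (s≤s (s≤s (s≤s ()))) _ | 1 , refl
... | suc (suc e) , refl = e , solve (e ∷ [])

lemma3p4 : (n : ℕ) → 5 ≤ n → ¬ (2 ∣ n) → (x : ℕ) → 2 ≤ x → x ≤ 5 * n + 2 →
    (InV 2 n x ⇔
      (x ≡ 2
      ⊎ (∃ λ k → x ≡ n + 2 * k × x + 1 ≤ 2 * n)
      ⊎ x ≡ 2 * n
      ⊎ (∃ λ k → x ≡ 2 * n + 1 + 2 * k × x + 2 ≤ 3 * n)
      ⊎ (∃ λ k → x ≡ 3 * n + 2 + 4 * k × x + 4 ≤ 5 * n)
      ⊎ x ≡ 5 * n + 2))
lemma3p4 n 5≤n 2∤n x _ x≤5n+2 with odd≥5⇒≡5+2e 5≤n 2∤n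
... | e , refl = Prefix.InV⇔PrefixSet e (≤-trans x≤5n+2 (≤-reflexive (solve (e ∷ []))))
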